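{- For every integer $n\ge 3$, the $(3,1)$ broadcast domination number of the $3\times n$ grid graph satisfies \[\gamma_{3,1}(G_{3,n})=\left\lceil \frac{n}{3}\right\rceil .\]
   Context: For positive integers $m,n$, $G_{m,n}$ denotes the $m\times n$ grid graph (the Cartesian product of a path on $m$ vertices and a path on $n$ vertices). For a graph $G=(V,E)$ with shortest-path distance $d$ and integers $1\le r\le t$, the reception strength of $u\in V$ with respect to $S\subseteq V$ is $r(u)=\sum_{v\in S,\ d(u,v)<t}\bigl(t-d(u,v)\bigr)$. A set $S\subseteq V$ is a $(t,r)$ broadcast dominating set if $r(u)\ge r$ for every $u\in V$. The $(t,r)$ broadcast domination number $\gamma_{t,r}(G)$ is the minimum cardinality of a $(t,r)$ broadcast dominating set of $G$. -}

module Defs where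

open import Data.Nat using (ℕ; _+_; _∸_; _≤_; _<_; _⊔_)
open import Relation.Binary.PropositionalEquality using (_≡_)
open import Data.Nat.DivMod using (_/_)
open import Data.Fin using (Fin; toℕ)
open import Data.Product using (_×_; _,_; Σ)
open import Data.List using (List; map; length)
open import Data.Nat.ListAction using (sum)
open import Data.List.Relation.Unary.Unique.Propositional using (Unique)

∣_-_∣ : ℕ → ℕ → ℕ
∣ a - b ∣ = (a ∸ b) + (b ∸ a)

GridVertex : ℕ → ℕ → Set
GridVertex m n = Fin m × Fin n

-- shortest-path distance in G_{m,n}: the Manhattan distance
gridDist : ∀ {m n} → GridVertex m n → GridVertex m n → ℕ
gridDist (i , j) (i' , j') = ∣ toℕ i - toℕ i' ∣ + ∣ toℕ j - toℕ j' ∣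

VertexSet : ℕ → ℕ → Set
VertexSet m n = Σ (List (GridVertex m n)) Unique

card : ∀ {m n} → VertexSet m n → ℕ
card (S , _) = length S

-- reception strength r(u) = Σ_{v∈S, d(u,v)<t} (t - d(u,v));
-- terms with d(u,v) ≥ t contribute t ∸ d(u,v) = 0.
reception : ∀ {m n} → ℕ → VertexSet m n → GridVertex m n → ℕ
reception t (S , _) u = sum (map (λ v → t ∸ gridDist u v) S)

IsBroadcastDominating : ∀ {m n} → ℕ → ℕ → VertexSet m n → Set
IsBroadcastDominating t r S = ∀ u → r ≤ reception t S u

BroadcastDominationNumber : ℕ → ℕ → ℕ → ℕ → ℕ → Set
BroadcastDominationNumber t r m n k =
  Σ (VertexSet m n) (λ S → IsBroadcastDominating t r S × card S ≡ k)
  × (∀ (S : VertexSet m n) → IsBroadcastDominating t r S → k ≤ card S)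

⌈_/3⌉ : ℕ → ℕ
⌈ n /3⌉ = (n + 2) / 3

module Submission where

-- A vertex has positive reception exactly when some tower lies within distance 2 of it.
-- Towers in the middle row at the columns ≡ 1 (mod 3), plus the last column when
-- n ≡ 1 (mod 3), therefore dominate: each reaches its own and both neighbouring columns.
-- Conversely a tower in row r is within distance 2 of only 5 − 2r vertices of the top
-- row and 2r + 1 of the bottom row, six in all, while each of the 2n outer vertices
-- needs such a tower; double counting gives 2n ≤ 6 |S|.

open import Defs
open import Data.Nat using (ℕ; _≤_; zero; suc; _+_; _*_; _∸_; _⊓_; z≤n; s≤s; >-nonZero; >-nonZero⁻¹)
open import Data.Nat.Properties
open import Data.Nat.DivMod using (m/n≡1+[m∸n]/n; m<n*o⇒m/o<n)
open import Data.Nat.ListAction using (sum)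
open import Algebra.Properties.CommutativeMonoid.Sum +-0-commutativeMonoid
  using (sum-syntax; sum-cong-≗; sum-replicate-zero; ∑-distrib-+; ∑-comm)
open import Data.Fin.Base using (Fin; toℕ; _↑ʳ_)
import Data.Fin.Base as Fin
open import Data.Fin.Patterns using (0F; 1F; 2F)
open import Data.Fin.Properties using (↑ʳ-injective)
open import Data.Product using (_,_)
open import Data.Product.Properties using (,-injectiveʳ)
open import Data.List.Base using (List; []; _∷_; map; length; lookup)
open import Data.List.Properties using (length-map)
open import Data.List.Relation.Unary.Any as Any using (Any; here; there)
import Data.List.Relation.Unary.Any.Properties as Anyₚ
open import Data.List.Relation.Unary.All using ([]; universal)
import Data.List.Relation.Unary.All.Properties as Allₚ
open import Data.List.Relation.Unary.AllPairs using ([]; _∷_)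
open import Data.List.Relation.Unary.Unique.Propositional using (Unique)
import Data.List.Relation.Unary.Unique.Propositional.Properties as Uniqueₚ
open import Relation.Binary.PropositionalEquality using (_≡_; refl; sym; trans; cong; cong₂; module ≡-Reasoning)

module _ {A : Set} where

  sum-map≡∑-lookup : (f : A → ℕ) (xs : List A) →
                     sum (map f xs) ≡ ∑[ i < length xs ] f (lookup xs i)
  sum-map≡∑-lookup f []       = refl
  sum-map≡∑-lookup f (x ∷ xs) = cong (f x +_) (sum-map≡∑-lookup f xs)

  any≤⇒≤sum : ∀ {k} {f : A → ℕ} {xs : List A} → Any (λ x → k ≤ f x) xs → k ≤ sum (map f xs)
  any≤⇒≤sum {f = f} {x ∷ xs} (here k≤fx) = ≤-trans k≤fx (m≤m+n (f x) _)
  any≤⇒≤sum {f = f} {x ∷ xs} (there p)   = ≤-trans (any≤⇒≤sum p) (m≤n+m _ (f x))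

∑-const : ∀ n b → ∑[ i < n ] b ≡ n * b
∑-const zero    b = refl
∑-const (suc n) b = cong (b +_) (∑-const n b)

∑-mono-≤ : ∀ {n} {f g : Fin n → ℕ} → (∀ i → f i ≤ g i) → ∑[ i < n ] f i ≤ ∑[ i < n ] g i
∑-mono-≤ {zero}  f≤g = z≤n
∑-mono-≤ {suc n} f≤g = +-mono-≤ (f≤g 0F) (∑-mono-≤ (λ i → f≤g (Fin.suc i)))

inRange : ℕ → ℕ → ℕ
inRange zero    d       = 0
inRange (suc t) zero    = 1
inRange (suc t) (suc d) = inRange t d

∸≤*inRange : ∀ t d → t ∸ d ≤ t * inRange t d
∸≤*inRange zero    d       = ≤-reflexive (0∸n≡0 d)
∸≤*inRange (suc t) zero    = ≤-reflexive (sym (*-identityʳ (suc t)))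
∸≤*inRange (suc t) (suc d) = ≤-trans (∸≤*inRange t d) (*-monoˡ-≤ (inRange t d) (n≤1+n t))

inRange-+-⊓ : ∀ k c → inRange k c + c ⊓ k ≡ suc c ⊓ k
inRange-+-⊓ zero    c       = ⊓-zeroʳ c
inRange-+-⊓ (suc k) zero    = refl
inRange-+-⊓ (suc k) (suc c) = trans (+-suc (inRange k c) (c ⊓ k)) (cong suc (inRange-+-⊓ k c))

∑-inRange≤ : ∀ n k → ∑[ j < n ] inRange k (toℕ j) ≤ k
∑-inRange≤ n       zero    = ≤-reflexive (sum-replicate-zero n)
∑-inRange≤ zero    (suc k) = z≤n
∑-inRange≤ (suc n) (suc k) = s≤s (∑-inRange≤ n k)

-- c ⊓ k bounds the columns in range to the left of c, suc k those from c on.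
∑-inRange-∣-∣≤⊓ : ∀ n c k → ∑[ j < n ] inRange (suc k) ∣ toℕ j - c ∣ ≤ c ⊓ k + suc k
∑-inRange-∣-∣≤⊓ zero    c       k = z≤n
∑-inRange-∣-∣≤⊓ (suc n) zero    k =
  s≤s (≤-trans (≤-reflexive (sum-cong-≗ {n} (λ j → cong (inRange k) (+-identityʳ (toℕ j))))) (∑-inRange≤ n k))
∑-inRange-∣-∣≤⊓ (suc n) (suc c) k = begin
  inRange k c + ∑[ j < n ] inRange (suc k) ∣ toℕ j - c ∣ ≤⟨ +-monoʳ-≤ (inRange k c) (∑-inRange-∣-∣≤⊓ n c k) ⟩
  inRange k c + (c ⊓ k + suc k)                         ≡⟨ +-assoc (inRange k c) _ _ ⟨
  (inRange k c + c ⊓ k) + suc k                         ≡⟨ cong (_+ suc k) (inRange-+-⊓ k c) ⟩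
  suc c ⊓ k + suc k                                     ∎
  where open ≤-Reasoning

∑-inRange-∣-∣≤ : ∀ n c k → ∑[ j < n ] inRange (suc k) ∣ toℕ j - c ∣ ≤ k + suc k
∑-inRange-∣-∣≤ n c k = ≤-trans (∑-inRange-∣-∣≤⊓ n c k) (+-monoˡ-≤ (suc k) (m⊓n≤n c k))

inRangeCount : ∀ {m n} → ℕ → VertexSet m n → GridVertex m n → ℕ
inRangeCount t (vs , _) u = sum (map (λ v → inRange t (gridDist u v)) vs)

reception≤*inRangeCount : ∀ {m n} t (S : VertexSet m n) u → reception t S u ≤ t * inRangeCount t S u
reception≤*inRangeCount t (vs , _) u = go vs
  where
  go : ∀ vs → sum (map (λ v → t ∸ gridDist u v) vs) ≤ t * sum (map (λ v → inRange t (gridDist u v)) vs)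
  go []       = ≤-reflexive (sym (*-zeroʳ t))
  go (v ∷ vs) = ≤-trans (+-mono-≤ (∸≤*inRange t (gridDist u v)) (go vs))
                        (≤-reflexive (sym (*-distribˡ-+ t _ _)))

dominating⇒inRangeCount-pos : ∀ {m n} t (S : VertexSet m n) → IsBroadcastDominating t 1 S →
                              ∀ u → 1 ≤ inRangeCount t S u
dominating⇒inRangeCount-pos t S dom u = >-nonZero⁻¹ _ {{m*n≢0⇒n≢0 t {{>-nonZero t*count-pos}}}}
  where
  t*count-pos : 1 ≤ t * inRangeCount t S u
  t*count-pos = ≤-trans (dom u) (reception≤*inRangeCount t S u)

∑-inRange-pair≤ : ∀ n c a b →
  ∑[ j < n ] (inRange (suc a) ∣ toℕ j - c ∣ + inRange (suc b) ∣ toℕ j - c ∣) ≤ (a + suc a) + (b + suc b)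
∑-inRange-pair≤ n c a b = ≤-trans (≤-reflexive (∑-distrib-+ {n} (λ j → inRange (suc a) ∣ toℕ j - c ∣) _))
                                 (+-mono-≤ (∑-inRange-∣-∣≤ n c a) (∑-inRange-∣-∣≤ n c b))

∑-outerRows-inRange≤6 : ∀ {n} (v : GridVertex 3 n) →
                   ∑[ j < n ] (inRange 3 (gridDist (0F , j) v) + inRange 3 (gridDist (2F , j) v)) ≤ 6
∑-outerRows-inRange≤6 {n} (0F , c) = ∑-inRange-pair≤ n (toℕ c) 2 0
∑-outerRows-inRange≤6 {n} (1F , c) = ∑-inRange-pair≤ n (toℕ c) 1 1
∑-outerRows-inRange≤6 {n} (2F , c) = ∑-inRange-pair≤ n (toℕ c) 0 2

∑-outerRows-inRangeCount≤ : ∀ {n} (S : VertexSet 3 n) →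
  ∑[ j < n ] (inRangeCount 3 S (0F , j) + inRangeCount 3 S (2F , j)) ≤ card S * 6
∑-outerRows-inRangeCount≤ {n} S@(vs , _) = begin
  ∑[ j < n ] (inRangeCount 3 S (0F , j) + inRangeCount 3 S (2F , j))
    ≡⟨ sum-cong-≗ {n} (λ j → cong₂ _+_ (sum-map≡∑-lookup _ vs) (sum-map≡∑-lookup _ vs)) ⟩
  ∑[ j < n ] (∑[ i < k ] top j i + ∑[ i < k ] bottom j i)
    ≡⟨ sum-cong-≗ {n} (λ j → ∑-distrib-+ (top j) (bottom j)) ⟨
  ∑[ j < n ] ∑[ i < k ] (top j i + bottom j i)
    ≡⟨ ∑-comm (λ j i → top j i + bottom j i) ⟩
  ∑[ i < k ] ∑[ j < n ] (top j i + bottom j i)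
    ≤⟨ ∑-mono-≤ (λ i → ∑-outerRows-inRange≤6 (lookup vs i)) ⟩
  ∑[ i < k ] 6
    ≡⟨ ∑-const k 6 ⟩
  k * 6 ∎
  where
  open ≤-Reasoning
  k = length vs
  top bottom : Fin n → Fin k → ℕ
  top    j i = inRange 3 (gridDist (0F , j) (lookup vs i))
  bottom j i = inRange 3 (gridDist (2F , j) (lookup vs i))

⌈/3⌉-≤ : ∀ {n k} → n ≤ k * 3 → ⌈ n /3⌉ ≤ k
⌈/3⌉-≤ {n} {k} n≤3k = ≤-pred (m<n*o⇒m/o<n (≤-trans (s≤s (+-monoˡ-≤ 2 n≤3k))
                                                     (≤-reflexive (cong suc (+-comm (k * 3) 2)))))

lowerBound : ∀ n (S : VertexSet 3 n) → IsBroadcastDominating 3 1 S → ⌈ n /3⌉ ≤ card S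
lowerBound n S dom = ⌈/3⌉-≤ (*-cancelʳ-≤ n (card S * 3) 2 (begin
  n * 2                                                                ≡⟨ ∑-const n 2 ⟨
  ∑[ j < n ] 2                                                         ≤⟨ ∑-mono-≤ covered ⟩
  ∑[ j < n ] (inRangeCount 3 S (0F , j) + inRangeCount 3 S (2F , j))  ≤⟨ ∑-outerRows-inRangeCount≤ S ⟩
  card S * 6                                                           ≡⟨ *-assoc (card S) 3 2 ⟨
  card S * 3 * 2                                                       ∎))
  where
  open ≤-Reasoning
  covered : ∀ j → 2 ≤ inRangeCount 3 S (0F , j) + inRangeCount 3 S (2F , j)
  covered j = +-mono-≤ (dominating⇒inRangeCount-pos 3 S dom (0F , j))
                       (dominating⇒inRangeCount-pos 3 S dom (2F , j))

towerColumns : ∀ n → List (Fin n)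
towerColumns 0                   = []
towerColumns 1                   = 0F ∷ []
towerColumns 2                   = 1F ∷ []
towerColumns (suc (suc (suc n))) = 1F ∷ map (3 ↑ʳ_) (towerColumns n)

towerColumns-unique : ∀ n → Unique (towerColumns n)
towerColumns-unique 0                   = []
towerColumns-unique 1                   = [] ∷ []
towerColumns-unique 2                   = [] ∷ []
towerColumns-unique (suc (suc (suc n))) =
  Allₚ.map⁺ (universal (λ _ ()) (towerColumns n)) ∷ Uniqueₚ.map⁺ (↑ʳ-injective 3 _ _) (towerColumns-unique n)

length-towerColumns : ∀ n → length (towerColumns n) ≡ ⌈ n /3⌉
length-towerColumns 0                   = refl
length-towerColumns 1                   = refl
length-towerColumns 2                   = refl
length-towerColumns (suc (suc (suc n))) = begin
  suc (length (map (3 ↑ʳ_) (towerColumns n))) ≡⟨ cong suc (length-map (3 ↑ʳ_) (towerColumns n)) ⟩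
  suc (length (towerColumns n))               ≡⟨ cong suc (length-towerColumns n) ⟩
  suc ⌈ n /3⌉                                 ≡⟨ m/n≡1+[m∸n]/n {3 + n + 2} (s≤s (s≤s (s≤s z≤n))) ⟨
  ⌈ 3 + n /3⌉                                 ∎
  where open ≡-Reasoning

towerColumns-near : ∀ {n} (j : Fin n) → Any (λ c → ∣ toℕ j - toℕ c ∣ ≤ 1) (towerColumns n)
towerColumns-near {1}                   0F = here z≤n
towerColumns-near {2}                   0F = here ≤-refl
towerColumns-near {2}                   1F = here z≤n
towerColumns-near {suc (suc (suc n))}   0F = here ≤-refl
towerColumns-near {suc (suc (suc n))}   1F = here z≤n
towerColumns-near {suc (suc (suc n))}   2F = here ≤-refl
towerColumns-near {suc (suc (suc n))} (Fin.suc (Fin.suc (Fin.suc j))) = there (Anyₚ.map⁺ (towerColumns-near j))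

∣-1∣≤1 : (r : Fin 3) → ∣ toℕ r - 1 ∣ ≤ 1
∣-1∣≤1 0F = ≤-refl
∣-1∣≤1 1F = z≤n
∣-1∣≤1 2F = ≤-refl

inMiddleRow : ∀ {n} → Fin n → GridVertex 3 n
inMiddleRow c = 1F , c

middleTowers : ∀ n → VertexSet 3 n
middleTowers n = map inMiddleRow (towerColumns n) , Uniqueₚ.map⁺ ,-injectiveʳ (towerColumns-unique n)

middleTowers-dominating : ∀ n → IsBroadcastDominating 3 1 (middleTowers n)
middleTowers-dominating n (r , j) = any≤⇒≤sum (Anyₚ.map⁺ (Any.map reaches (towerColumns-near j)))
  where
  reaches : ∀ {c} → ∣ toℕ j - toℕ c ∣ ≤ 1 → 1 ≤ 3 ∸ gridDist (r , j) (1F , c)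
  reaches near = ∸-monoʳ-≤ 3 (+-mono-≤ (∣-1∣≤1 r) near)

card-middleTowers : ∀ n → card (middleTowers n) ≡ ⌈ n /3⌉
card-middleTowers n = trans (length-map inMiddleRow (towerColumns n)) (length-towerColumns n)

mainTheorem4 : ∀ (n : ℕ) → 3 ≤ n → BroadcastDominationNumber 3 1 3 n ⌈ n /3⌉
mainTheorem4 n _ = (middleTowers n , middleTowers-dominating n , card-middleTowers n)
                 , lowerBound n
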